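{- Let $b\ge 2$, and let $N$ be a $b$-MRH number with $k$ digits in base $b$ and multiplicative multiplier $M$. Then $k\le M+4$ if $b\ge 6$; $k\le M+5$ if $b=5$; and $k\le M+7$ if $2\le b\le 4$.
   Context: For a positive integer $N$, $s_b(N)$ is the sum of the base-$b$ digits of $N$, and the reversal $N^R$ is the integer obtained by writing the base-$b$ digits of $N$ in reverse order. A positive integer $N$ is a $b$-MRH number if there exists a positive integer $M$ (called a multiplicative multiplier of $N$) such that $N=Ms_b(N)\cdot(Ms_b(N))^R$. -}

module Defs where

open import Data.Nat using (ℕ; zero; suc; _+_; _*_; _≤_; NonZero)
open import Data.Nat.DivMod using (_/_; _%_)
open import Data.List using (List; []; _∷_; length; reverse; foldr)
open import Data.Nat.ListAction using (sum)
open import Data.Product using (_×_)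
open import Relation.Binary.PropositionalEquality using (_≡_)

-- Base-b digits of n, least significant first, computed with fuel.
-- Fuel n suffices since each step divides by b ≥ 2. digits of 0 is [].
digitsAux : (b : ℕ) → .{{NonZero b}} → ℕ → ℕ → List ℕ
digitsAux b zero    n = []
digitsAux b (suc f) zero = []
digitsAux b (suc f) n@(suc _) = (n % b) ∷ digitsAux b f (n / b)

digits : (b : ℕ) → .{{NonZero b}} → ℕ → List ℕ
digits b n = digitsAux b n n

numDigits : (b : ℕ) → .{{NonZero b}} → ℕ → ℕ
numDigits b n = length (digits b n)

digitSum : (b : ℕ) → .{{NonZero b}} → ℕ → ℕ
digitSum b n = sum (digits b n)

fromDigits : ℕ → List ℕ → ℕ
fromDigits b = foldr (λ d acc → d + b * acc) 0

reversal : (b : ℕ) → .{{NonZero b}} → ℕ → ℕ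
reversal b n = fromDigits b (reverse (digits b n))

IsMRHWith : (b : ℕ) → .{{NonZero b}} → ℕ → ℕ → Set
IsMRHWith b N M =
  1 ≤ N × 1 ≤ M × N ≡ (M * digitSum b N) * reversal b (M * digitSum b N)

module Submission where

-- Let N = X · X^R with X = M · s_b(N), and let k be the number of base-b
-- digits of N.  Since b^(k-1) ≤ N, X^R < b·X and s_b(N) ≤ (b-1)k, we get
--
--     b^k ≤ b·N = b·X·X^R < (b·X)² ≤ (b · M · (b-1) · k)².          (*)
--
-- If k exceeded M + t we could write k = j + (t+1) with M ≤ j, and (*) would
-- give b^(j+t+1) < (b·j·(b-1)·(j+t+1))².  The right-hand side is (the square
-- of) a quadratic in j, so the exponential side wins for all j ≥ 1 once the
-- offset t is large enough; this is proved by a two-step induction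
-- ('square-≤-power'), the ratio of the quadratic over two steps being at most b.
-- The offsets 4 (b ≥ 6, reduced to b = 6), 5 (b = 5) and 7 (b = 3, 4) work for
-- every j ≥ 1.  For b = 2 the exponential only wins from j = 8 on; the finitely
-- many remaining cases (M ≤ 7, s_2(N) ≤ 15) are settled by computation.

open import Defs
open import Data.Nat using (ℕ; _+_; _≤_; _≥_; NonZero)
open import Data.Sum using (_⊎_)
open import Data.Product using (_×_)
open import Relation.Binary.PropositionalEquality using (_≡_)

open import Data.Nat
  using (zero; suc; _*_; _∸_; _^_; _<_; z≤n; s≤s; >-nonZero; >-nonZero⁻¹; _≤?_; _≟_)
open import Data.Nat.Properties
open import Data.Nat.DivMod using (_/_; m%n<n; m/n*n≤m)
open import Data.Nat.ListAction using (sum)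
open import Data.Nat.Tactic.RingSolver using (solve-∀)
open import Data.List using ([]; _∷_; length; reverse)
open import Data.List.Properties using (length-reverse)
open import Data.List.Relation.Unary.All using (All; []; _∷_)
open import Data.List.Relation.Binary.Permutation.Propositional using (↭-sym)
open import Data.List.Relation.Binary.Permutation.Propositional.Properties
  using (All-resp-↭; ↭-reverse)
open import Data.Fin using (Fin; toℕ; fromℕ<)
open import Data.Fin.Properties using (all?; toℕ-fromℕ<)
open import Data.Product using (_,_; proj₁; proj₂; ∃-syntax)
open import Data.Sum using (inj₁; inj₂)
open import Data.Unit using (tt)
open import Data.Empty using (⊥-elim)
open import Relation.Nullary using (yes; no)
open import Relation.Nullary.Decidable using (Dec; toWitness; _→-dec_)
open import Relation.Binary.PropositionalEquality using (refl; sym; cong; subst; subst₂; module ≡-Reasoning)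

sq : ℕ → ℕ
sq x = x * x

sq-mono : ∀ {x y} → x ≤ y → sq x ≤ sq y
sq-mono x≤y = *-mono-≤ x≤y x≤y

≤-by-slack : ∀ x d {y} → y ≡ x + d → x ≤ y
≤-by-slack x d y≡ = subst (x ≤_) (sym y≡) (m≤m+n x d)

fromDigits-< : ∀ b xs → All (_< b) xs → fromDigits b xs < b ^ length xs
fromDigits-< b [] [] = s≤s z≤n
fromDigits-< b (x ∷ xs) (x<b ∷ xs<b) = begin-strict
    x + b * fromDigits b xs  <⟨ +-monoˡ-< (b * fromDigits b xs) x<b ⟩
    b + b * fromDigits b xs  ≡⟨ sym (*-suc b _) ⟩
    b * suc (fromDigits b xs) ≤⟨ *-monoʳ-≤ b (fromDigits-< b xs xs<b) ⟩
    b * b ^ length xs        ∎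
  where open ≤-Reasoning

sum-≤ : ∀ b xs → All (_< b) xs → sum xs ≤ (b ∸ 1) * length xs
sum-≤ b [] [] = z≤n
sum-≤ b (x ∷ xs) (x<b ∷ xs<b) = begin
    x + sum xs                  ≤⟨ +-mono-≤ (≤-pred (≤-trans x<b (m≤n+m∸n b 1))) (sum-≤ b xs xs<b) ⟩
    (b ∸ 1) + (b ∸ 1) * length xs ≡⟨ sym (*-suc (b ∸ 1) (length xs)) ⟩
    (b ∸ 1) * suc (length xs)     ∎
  where open ≤-Reasoning

module _ (b : ℕ) .{{_ : NonZero b}} where

  digitsAux-zero : ∀ f → digitsAux b f 0 ≡ []
  digitsAux-zero zero = refl
  digitsAux-zero (suc f) = refl

  digitsAux-< : ∀ f n → All (_< b) (digitsAux b f n)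
  digitsAux-< zero n = []
  digitsAux-< (suc f) zero = []
  digitsAux-< (suc f) (suc n) = m%n<n (suc n) b ∷ digitsAux-< f (suc n / b)

  digitsAux-length : ∀ f n → b ^ length (digitsAux b f (suc n)) ≤ b * suc n
  digitsAux-length zero n = ≤-trans (>-nonZero⁻¹ b) (m≤m*n b (suc n))
  digitsAux-length (suc f) n with suc n / b in q≡
  ... | zero rewrite digitsAux-zero f = *-monoʳ-≤ b (s≤s z≤n)
  ... | suc q = begin
      b * b ^ length (digitsAux b f (suc q)) ≤⟨ *-monoʳ-≤ b (digitsAux-length f q) ⟩
      b * (b * suc q)                        ≡⟨ cong (λ z → b * (b * z)) (sym q≡) ⟩
      b * (b * (suc n / b))                  ≤⟨ *-monoʳ-≤ b b*q≤n ⟩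
      b * suc n                              ∎
    where
      open ≤-Reasoning
      b*q≤n : b * (suc n / b) ≤ suc n
      b*q≤n = subst (_≤ suc n) (*-comm (suc n / b) b) (m/n*n≤m (suc n) b)

  digits-< : ∀ n → All (_< b) (digits b n)
  digits-< n = digitsAux-< n n

  power-numDigits-≤ : ∀ n → 1 ≤ n → b ^ numDigits b n ≤ b * n
  power-numDigits-≤ (suc n) _ = digitsAux-length (suc n) n

  digitSum-≤ : ∀ n → digitSum b n ≤ (b ∸ 1) * numDigits b n
  digitSum-≤ n = sum-≤ b (digits b n) (digits-< n)

  -- The reversal has no more digits than n, hence n^R < b^k ≤ b·n.
  reversal-< : ∀ n → 1 ≤ n → reversal b n < b * n
  reversal-< n n≥1 = <-≤-trans reversal<power (power-numDigits-≤ n n≥1)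
    where
      reversed-digits-< : All (_< b) (reverse (digits b n))
      reversed-digits-< = All-resp-↭ (↭-sym (↭-reverse (digits b n))) (digits-< n)
      reversal<power : reversal b n < b ^ numDigits b n
      reversal<power = subst (λ L → reversal b n < b ^ L) (length-reverse (digits b n))
        (fromDigits-< b (reverse (digits b n)) reversed-digits-<)

-- b · j · (b-1) · (j+c): the bound on b·M·s_b(N) when M ≤ j and N has j+c digits.
mrhBound : ℕ → ℕ → ℕ → ℕ
mrhBound b c j = b * (j * ((b ∸ 1) * (j + c)))

mrh-power-< : ∀ b N M .{{_ : NonZero b}} → IsMRHWith b N M →
  b ^ numDigits b N < sq (b * (M * ((b ∸ 1) * numDigits b N)))
mrh-power-< b N M (N≥1 , _ , N≡) = begin-strict
    b ^ k                  ≤⟨ power-numDigits-≤ b N N≥1 ⟩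
    b * N                  ≡⟨ cong (b *_) N≡ ⟩
    b * (X * reversal b X) <⟨ *-monoʳ-< b (*-monoʳ-< X {{X≢0}} (reversal-< b X X≥1)) ⟩
    b * (X * (b * X))      ≡⟨ regroup b X ⟩
    sq (b * X)             ≤⟨ sq-mono (*-monoʳ-≤ b (*-monoʳ-≤ M (digitSum-≤ b N))) ⟩
    sq (b * (M * ((b ∸ 1) * k))) ∎
  where
    open ≤-Reasoning
    k = numDigits b N
    X = M * digitSum b N
    X≢0 : NonZero X
    X≢0 = m*n≢0⇒m≢0 X {{subst NonZero N≡ (>-nonZero N≥1)}}
    X≥1 : 1 ≤ X
    X≥1 = >-nonZero⁻¹ X {{X≢0}}
    regroup : ∀ b X → b * (X * (b * X)) ≡ (b * X) * (b * X)
    regroup = solve-∀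

mrh-shifted-< : ∀ b N M c j .{{_ : NonZero b}} → IsMRHWith b N M → M ≤ j →
  numDigits b N ≡ j + c → b ^ (j + c) < sq (mrhBound b c j)
mrh-shifted-< b N M c j mrh M≤j k≡ = <-≤-trans
  (subst (λ k → b ^ k < sq (b * (M * ((b ∸ 1) * k)))) k≡ (mrh-power-< b N M mrh))
  (sq-mono (*-monoʳ-≤ b (*-monoˡ-≤ ((b ∸ 1) * (j + c)) M≤j)))

≤-or-excess : ∀ k m t → k ≤ m + t ⊎ ∃[ j ] (m ≤ j × k ≡ j + suc t)
≤-or-excess k m t with k ≤? m + t
... | yes k≤ = inj₁ k≤
... | no k≰ = inj₂ (k ∸ suc t , m+n≤o⇒m≤o∸n m m+t<k , sym (m∸n+n≡m (m+n≤o⇒n≤o m m+t<k)))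
  where
    m+t<k : m + suc t ≤ k
    m+t<k = subst (_≤ k) (sym (+-suc m t)) (≰⇒> k≰)

numDigits-≤ : ∀ b N M t .{{_ : NonZero b}} → IsMRHWith b N M →
  (∀ j → 1 ≤ j → sq (mrhBound b (suc t) j) ≤ b ^ (j + suc t)) →
  numDigits b N ≤ M + t
numDigits-≤ b N M t mrh power-wins with ≤-or-excess (numDigits b N) M t
... | inj₁ k≤ = k≤
... | inj₂ (j , M≤j , k≡) = ⊥-elim (<⇒≱ (mrh-shifted-< b N M (suc t) j mrh M≤j k≡)
        (power-wins j (≤-trans (proj₁ (proj₂ mrh)) M≤j)))

square-≤-power : (Q : ℕ → ℕ) (r e j₀ : ℕ) →
  (∀ i → Q (2 + (i + j₀)) ≤ r * Q (i + j₀)) →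
  sq (Q j₀) ≤ r ^ (j₀ + e) → sq (Q (1 + j₀)) ≤ r ^ (1 + j₀ + e) →
  ∀ j → j₀ ≤ j → sq (Q j) ≤ r ^ (j + e)
square-≤-power Q r e j₀ step base₀ base₁ j j₀≤j =
  subst (λ x → sq (Q x) ≤ r ^ (x + e)) (m∸n+n≡m j₀≤j) (proj₁ (consecutive (j ∸ j₀)))
  where
    consecutive : ∀ i → sq (Q (i + j₀)) ≤ r ^ (i + j₀ + e)
                      × sq (Q (1 + (i + j₀))) ≤ r ^ (1 + (i + j₀) + e)
    consecutive zero = base₀ , base₁
    consecutive (suc i) = h₁ , (begin
        sq (Q (2 + n))       ≤⟨ sq-mono (step i) ⟩
        sq (r * Q n)         ≡⟨ square-product r (Q n) ⟩
        r * (r * sq (Q n))   ≤⟨ *-monoʳ-≤ r (*-monoʳ-≤ r h₀) ⟩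
        r * (r * r ^ (n + e)) ∎)
      where
        open ≤-Reasoning
        n = i + j₀
        h₀ = proj₁ (consecutive i)
        h₁ = proj₂ (consecutive i)
        square-product : ∀ r x → (r * x) * (r * x) ≡ r * (r * (x * x))
        square-product = solve-∀

-- Base 6, in the reduced form used for all b ≥ 6: (j(j+5))² ≤ 6^(j+1).
base6-growth : ∀ j → 1 ≤ j → sq (j * (j + 5)) ≤ 6 ^ (j + 1)
base6-growth = square-≤-power (λ j → j * (j + 5)) 6 1 1 step (≤ᵇ⇒≤ _ _ tt) (≤ᵇ⇒≤ _ _ tt)
  where
    slack : ∀ i → 6 * ((i + 1) * ((i + 1) + 5))
                ≡ (2 + (i + 1)) * ((2 + (i + 1)) + 5) + (12 + 31 * i + 5 * i * i)
    slack = solve-∀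
    step : ∀ i → (2 + (i + 1)) * ((2 + (i + 1)) + 5) ≤ 6 * ((i + 1) * ((i + 1) + 5))
    step i = ≤-by-slack _ _ (slack i)

power-shift : ∀ b j → ((b * b) * (b * b)) * b ^ (j + 1) ≡ b ^ (j + 5)
power-shift b j = begin
    ((b * b) * (b * b)) * b ^ (j + 1)   ≡⟨ cong (((b * b) * (b * b)) *_) (^-distribˡ-+-* b j 1) ⟩
    ((b * b) * (b * b)) * (b ^ j * b ^ 1) ≡⟨ regroup b (b ^ j) ⟩
    b ^ j * b ^ 5                       ≡⟨ sym (^-distribˡ-+-* b j 5) ⟩
    b ^ (j + 5)                         ∎
  where
    open ≡-Reasoning
    regroup : ∀ b x → ((b * b) * (b * b)) * (x * (b * 1)) ≡ x * (b * (b * (b * (b * (b * 1)))))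
    regroup = solve-∀

large-base-growth : ∀ b → 6 ≤ b → ∀ j → 1 ≤ j → sq (mrhBound b 5 j) ≤ b ^ (j + 5)
large-base-growth b b≥6 j j≥1 = begin
    sq (b * (j * ((b ∸ 1) * (j + 5)))) ≤⟨ sq-mono (*-monoʳ-≤ b (*-monoʳ-≤ j (*-monoˡ-≤ (j + 5) (m∸n≤m b 1)))) ⟩
    sq (b * (j * (b * (j + 5))))       ≡⟨ factor b j ⟩
    b⁴ * sq (j * (j + 5))              ≤⟨ *-monoʳ-≤ b⁴ (base6-growth j j≥1) ⟩
    b⁴ * 6 ^ (j + 1)                   ≤⟨ *-monoʳ-≤ b⁴ (^-monoˡ-≤ (j + 1) b≥6) ⟩
    b⁴ * b ^ (j + 1)                   ≡⟨ power-shift b j ⟩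
    b ^ (j + 5)                        ∎
  where
    open ≤-Reasoning
    b⁴ = (b * b) * (b * b)
    factor : ∀ b j → (b * (j * (b * (j + 5)))) * (b * (j * (b * (j + 5))))
                   ≡ ((b * b) * (b * b)) * ((j * (j + 5)) * (j * (j + 5)))
    factor = solve-∀

base5-growth : ∀ j → 1 ≤ j → sq (mrhBound 5 6 j) ≤ 5 ^ (j + 6)
base5-growth = square-≤-power (mrhBound 5 6) 5 6 1 step (≤ᵇ⇒≤ _ _ tt) (≤ᵇ⇒≤ _ _ tt)
  where
    slack : ∀ i → 5 * (5 * ((i + 1) * (4 * ((i + 1) + 6))))
                ≡ 5 * ((2 + (i + 1)) * (4 * ((2 + (i + 1)) + 6))) + (160 + 560 * i + 80 * i * i)
    slack = solve-∀
    step : ∀ i → mrhBound 5 6 (2 + (i + 1)) ≤ 5 * mrhBound 5 6 (i + 1)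
    step i = ≤-by-slack _ _ (slack i)

base4-growth : ∀ j → 1 ≤ j → sq (mrhBound 4 8 j) ≤ 4 ^ (j + 8)
base4-growth = square-≤-power (mrhBound 4 8) 4 8 1 step (≤ᵇ⇒≤ _ _ tt) (≤ᵇ⇒≤ _ _ tt)
  where
    slack : ∀ i → 4 * (4 * ((i + 1) * (3 * ((i + 1) + 8))))
                ≡ 4 * ((2 + (i + 1)) * (3 * ((2 + (i + 1)) + 8))) + (36 + 312 * i + 36 * i * i)
    slack = solve-∀
    step : ∀ i → mrhBound 4 8 (2 + (i + 1)) ≤ 4 * mrhBound 4 8 (i + 1)
    step i = ≤-by-slack _ _ (slack i)

-- For b = 3 the two-step ratio is small enough only from j = 2 on; j = 1 is direct.
base3-growth : ∀ j → 1 ≤ j → sq (mrhBound 3 8 j) ≤ 3 ^ (j + 8)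
base3-growth 1 _ = ≤ᵇ⇒≤ _ _ tt
base3-growth j@(suc (suc _)) _ =
  square-≤-power (mrhBound 3 8) 3 8 2 step (≤ᵇ⇒≤ _ _ tt) (≤ᵇ⇒≤ _ _ tt) j (s≤s (s≤s z≤n))
  where
    slack : ∀ i → 3 * (3 * ((i + 2) * (2 * ((i + 2) + 8))))
                ≡ 3 * ((2 + (i + 2)) * (2 * ((2 + (i + 2)) + 8))) + (72 + 120 * i + 12 * i * i)
    slack = solve-∀
    step : ∀ i → mrhBound 3 8 (2 + (i + 2)) ≤ 3 * mrhBound 3 8 (i + 2)
    step i = ≤-by-slack _ _ (slack i)

base2-growth : ∀ j → 8 ≤ j → sq (mrhBound 2 8 j) ≤ 2 ^ (j + 8)
base2-growth = square-≤-power (mrhBound 2 8) 2 8 8 step (≤ᵇ⇒≤ _ _ tt) (≤ᵇ⇒≤ _ _ tt)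
  where
    slack : ∀ i → 2 * (2 * ((i + 8) * (1 * ((i + 8) + 8))))
                ≡ 2 * ((2 + (i + 8)) * (1 * ((2 + (i + 8)) + 8))) + (152 + 40 * i + 2 * i * i)
    slack = solve-∀
    step : ∀ i → mrhBound 2 8 (2 + (i + 8)) ≤ 2 * mrhBound 2 8 (i + 8)
    step i = ≤-by-slack _ _ (slack i)

large-base : ∀ b N M .{{_ : NonZero b}} → 6 ≤ b → IsMRHWith b N M → numDigits b N ≤ M + 4
large-base b N M b≥6 mrh = numDigits-≤ b N M 4 mrh (large-base-growth b b≥6)

base-five : ∀ b N M .{{_ : NonZero b}} → b ≡ 5 → IsMRHWith b N M → numDigits b N ≤ M + 5
base-five .5 N M refl mrh = numDigits-≤ 5 N M 5 mrh base5-growth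

-- The binary candidates N = X · X^R (X = M·s) with M ≤ 7 and s ≤ 15, checked
-- exhaustively: whenever s is the binary digit sum of N, N has at most M + 7 digits.
SmallBinaryCase : ℕ → ℕ → Set
SmallBinaryCase M s = digitSum 2 N ≡ s → numDigits 2 N ≤ M + 7
  where N = (M * s) * reversal 2 (M * s)

smallBinaryCase? : ∀ M s → Dec (SmallBinaryCase M s)
smallBinaryCase? M s = (digitSum 2 N ≟ s) →-dec (numDigits 2 N ≤? M + 7)
  where N = (M * s) * reversal 2 (M * s)

small-binary-cases : ∀ (M : Fin 8) (s : Fin 16) → SmallBinaryCase (toℕ M) (toℕ s)
small-binary-cases = toWitness {a? = all? λ M → all? λ s → smallBinaryCase? (toℕ M) (toℕ s)} tt

small-binary-case : ∀ M s → M ≤ 7 → s ≤ 15 → SmallBinaryCase M s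
small-binary-case M s M≤7 s≤15 = subst₂ SmallBinaryCase (toℕ-fromℕ< M<8) (toℕ-fromℕ< s<16)
  (small-binary-cases (fromℕ< M<8) (fromℕ< s<16))
  where
    M<8 = s≤s M≤7
    s<16 = s≤s s≤15

base-two : ∀ N M → IsMRHWith 2 N M → numDigits 2 N ≤ M + 7
base-two N M mrh with ≤-or-excess (numDigits 2 N) M 7
... | inj₁ k≤ = k≤
... | inj₂ (j , M≤j , k≡) with 8 ≤? j
...   | yes j≥8 = ⊥-elim (<⇒≱ (mrh-shifted-< 2 N M 8 j mrh M≤j k≡) (base2-growth j j≥8))
...   | no j≱8 = subst (λ x → numDigits 2 x ≤ M + 7) (sym N≡)
          (small-binary-case M s (≤-trans M≤j j≤7) s≤15 (cong (digitSum 2) (sym N≡)))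
  where
    s = digitSum 2 N
    N≡ = proj₂ (proj₂ mrh)
    j≤7 : j ≤ 7
    j≤7 = ≤-pred (≰⇒> j≱8)
    s≤15 : s ≤ 15
    s≤15 = begin
      s                  ≤⟨ digitSum-≤ 2 N ⟩
      1 * numDigits 2 N  ≡⟨ *-identityˡ _ ⟩
      numDigits 2 N      ≡⟨ k≡ ⟩
      j + 8              ≤⟨ +-monoˡ-≤ 8 j≤7 ⟩
      15                 ∎
      where open ≤-Reasoning

small-base : ∀ b N M .{{_ : NonZero b}} → 2 ≤ b → b ≤ 4 → IsMRHWith b N M → numDigits b N ≤ M + 7
small-base 0 N M () _ _
small-base 1 N M (s≤s ()) _ _
small-base 2 N M _ _ mrh = base-two N M mrh
small-base 3 N M _ _ mrh = numDigits-≤ 3 N M 7 mrh base3-growth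
small-base 4 N M _ _ mrh = numDigits-≤ 4 N M 7 mrh base4-growth
small-base (suc (suc (suc (suc (suc _))))) N M _ (s≤s (s≤s (s≤s (s≤s ())))) _

theorem38 : (b N M : ℕ) → .{{_ : NonZero b}} → b ≥ 2 → IsMRHWith b N M →
    (b ≥ 6 → numDigits b N ≤ M + 4) ×
    (b ≡ 5 → numDigits b N ≤ M + 5) ×
    (b ≤ 4 → numDigits b N ≤ M + 7)
theorem38 b N M b≥2 mrh =
    (λ b≥6 → large-base b N M b≥6 mrh)
  , (λ b≡5 → base-five b N M b≡5 mrh)
  , (λ b≤4 → small-base b N M b≥2 b≤4 mrh)
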